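{- Let $k\in\mathbb{Z}$ with $k\equiv \pm2 \pmod{12}$. Then $\operatorname{Ker}\nu_{\eta^{2k}}=\operatorname{Ker}\nu_{\eta^{12}}\cap\operatorname{Ker}\nu_{\eta^{8}}$. Moreover, the matrices $S^n$ $(0\le n\le 5)$, where $S=\begin{pmatrix} 1&1\\ 0&1\end{pmatrix}$, form a complete set of coset representatives of $\Gamma(1)$ modulo $\operatorname{Ker}\nu_{\eta^{2k}}$.
   Context: Let $\Gamma(1)=SL(2,\mathbb{Z})$, acting on the upper half plane $\mathscr{H}=\{\tau\in\mathbb{C}:\Im\tau>0\}$ by $M\tau=\frac{a\tau+b}{c\tau+d}$ for $M=\begin{pmatrix} a&b\\ c&d\end{pmatrix}$. Let $\eta(\tau)=q^{1/24}\prod_{n\ge1}(1-q^n)$ with $q=e^{2\pi i\tau}$ and $q^{1/24}=e^{2\pi i\tau/24}$. For $m\in\mathbb{Z}$, the multiplier system $\nu_{\eta^{2m}}:\Gamma(1)\to\mathbb{C}^\times$ is defined by $\eta^{2m}(M\tau)=\nu_{\eta^{2m}}(M)(c\tau+d)^m\eta^{2m}(\tau)$ for all $\tau\in\mathscr{H}$; it is a character of $\Gamma(1)$, given explicitly by $\nu_{\eta^{2m}}(M)=\exp\{\frac{m\pi i}{6}f(M)\}$, where $f(M)=(a+d)c-bd(c^2-1)-3c$ if $c$ is odd and $f(M)=(a+d)c-bd(c^2-1)+3d-3-3cd$ if $c$ is even. $\operatorname{Ker}\nu_{\eta^{2m}}$ denotes its kernel (so $\nu_{\eta^{12}}$ and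 $\nu_{\eta^8}$ are the cases $m=6$ and $m=4$). -}

module Defs where

open import Data.Nat as ℕ using (ℕ)
open import Data.Integer using (ℤ; +_; _+_; _-_; _*_; -_; ∣_∣)
open import Data.Integer.Divisibility using (_∣_)
open import Data.Fin using (Fin; toℕ)
open import Data.Product using (Σ)
open import Relation.Binary.PropositionalEquality using (_≡_)

record Mat2 : Set where
  constructor mat
  field
    a b c d : ℤ
open Mat2 public

det : Mat2 → ℤ
det M = a M * d M - b M * c M

SL2Z : Set
SL2Z = Σ Mat2 (λ M → det M ≡ + 1)

_·_ : Mat2 → Mat2 → Mat2
mat a₁ b₁ c₁ d₁ · mat a₂ b₂ c₂ d₂ =
  mat (a₁ * a₂ + b₁ * c₂) (a₁ * b₂ + b₁ * d₂)
      (c₁ * a₂ + d₁ * c₂) (c₁ * b₂ + d₁ * d₂)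
infixl 7 _·_

S : Mat2
S = mat (+ 1) (+ 1) (+ 0) (+ 1)

Sinv : Mat2
Sinv = mat (+ 1) (- (+ 1)) (+ 0) (+ 1)

one : Mat2
one = mat (+ 1) (+ 0) (+ 0) (+ 1)

_^_ : Mat2 → ℕ → Mat2
M ^ ℕ.zero  = one
M ^ ℕ.suc n = M · (M ^ n)

-- f(M) from the explicit formula for the multiplier system
f : Mat2 → ℤ
f (mat a b c d) with ∣ c ∣ ℕ.% 2
... | ℕ.zero = (a + d) * c - b * d * (c * c - + 1) + + 3 * d - + 3 - + 3 * c * d
... | ℕ.suc _ = (a + d) * c - b * d * (c * c - + 1) - + 3 * c

-- ν_{η^{2m}}(M) = exp(m π i f(M) / 6) = ζ₁₂^{m f(M)}; it equals 1 iff 12 ∣ m f(M).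
-- M ∈ Ker ν_{η^{2m}}  (for M ∈ Γ(1)):
InKer : ℤ → Mat2 → Set
InKer m M = + 12 ∣ m * f M

-- The character ν_{η^{2k}} sends M to ζ₁₂^{k f(M)}, and for k ≡ ±2 (mod 12) this is trivial exactly
-- when 6 ∣ f(M), i.e. when both 2 ∣ f(M) (kernel of ν_{η^{12}}) and 3 ∣ f(M) (kernel of ν_{η^8}).
-- Left multiplication by S⁻ⁿ changes f by −n + n(c²−1)(d²−1), and for coprime c, d the product
-- (c²−1)(d²−1) is divisible by 6; so f(S⁻ⁿM) ≡ f(M) − n (mod 6), and the six powers Sⁿ, for which
-- f(Sⁿ) = n, represent the six cosets.
module Submission where

open import Defs
open import Data.Integer using (ℤ; +_; _+_; _-_)
open import Data.Integer.Divisibility using (_∣_)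
open import Data.Fin using (Fin; toℕ)
open import Data.Product using (Σ; _×_; proj₁)
open import Data.Sum using (_⊎_)
open import Function.Bundles using (_⇔_)
open import Relation.Binary.PropositionalEquality using (_≡_)

open import Data.Integer using (_*_; -_; ∣_∣; _⊖_)
open import Data.Integer.Properties using (abs-*; *-identityʳ; m-n≡m⊖n; ∣m⊖n∣≡∣n⊖m∣; ∣⊖∣-≤)
open import Data.Integer.DivMod using (_%ℕ_; _/ℕ_; a≡a%ℕn+[a/ℕn]*n; n%ℕd<d)
open import Data.Integer.Divisibility.Signed as Signed using (divides; ∣ᵤ⇒∣; ∣⇒∣ᵤ)
  renaming (_∣_ to _∣ₛ_)
open import Data.Integer.Tactic.RingSolver using (solve-∀)
open import Data.Nat as ℕ using (ℕ; zero; suc; _∸_; _<_; _≤_)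
open import Data.Nat.Properties using (≤-total; ≤-antisym; ≤-<-trans; m∸n≤m; m∸n≡0⇒m≤n)
open import Data.Nat.DivMod using (_%_; m<n⇒m%n≡m)
import Data.Nat.Divisibility as ℕ
open import Data.Nat.LCM using (lcm-least)
open import Data.Fin.Properties using (toℕ<n; toℕ-injective; toℕ-fromℕ<)
open import Data.Fin using (fromℕ<)
open import Data.Product using (_,_)
open import Data.Product.Function.NonDependent.Propositional using (_×-⇔_)
open import Data.Sum using (inj₁; inj₂)
open import Function.Bundles using (mk⇔; Equivalence)
import Function.Properties.Equivalence as ⇔
open import Relation.Binary.PropositionalEquality
  using (refl; sym; trans; cong; subst; module ≡-Reasoning)

∣l∣*m∣l*x⇔m∣x : ∀ {l} m x .{{_ : ℕ.NonZero ∣ l ∣}} → (+ (∣ l ∣ ℕ.* m) ∣ l * x) ⇔ (+ m ∣ x)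
∣l∣*m∣l*x⇔m∣x {l} m x = subst (λ y → (∣ l ∣ ℕ.* m ℕ.∣ y) ⇔ (m ℕ.∣ ∣ x ∣)) (sym (abs-* l x))
  (mk⇔ (ℕ.*-cancelˡ-∣ ∣ l ∣) (ℕ.*-monoʳ-∣ ∣ l ∣))

∣k*x⇔∣l*x : ∀ {n k} l x → n ∣ k - l → (n ∣ k * x) ⇔ (n ∣ l * x)
∣k*x⇔∣l*x {n} {k} l x n∣k-l = mk⇔
  (λ n∣kx → ∣⇒∣ᵤ {n} {l * x}
    (Signed.∣m+n∣n⇒∣m (subst (n ∣ₛ_) (split k l x) (∣ᵤ⇒∣ {n} {k * x} n∣kx)) n∣[k-l]x))
  (λ n∣lx → ∣⇒∣ᵤ {n} {k * x}
    (subst (n ∣ₛ_) (sym (split k l x)) (Signed.∣m∣n⇒∣m+n (∣ᵤ⇒∣ {n} {l * x} n∣lx) n∣[k-l]x)))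
  where
  n∣[k-l]x : n ∣ₛ (k - l) * x
  n∣[k-l]x = Signed.∣m⇒∣m*n x (∣ᵤ⇒∣ {n} {k - l} n∣k-l)
  split : ∀ k l x → k * x ≡ l * x + (k - l) * x
  split = solve-∀

12∣k*x⇔6∣x : ∀ {k} x → (+ 12 ∣ k - + 2) ⊎ (+ 12 ∣ k + + 2) → (+ 12 ∣ k * x) ⇔ (+ 6 ∣ x)
12∣k*x⇔6∣x {k} x (inj₁ k≡2) =
  ⇔.trans (∣k*x⇔∣l*x {+ 12} {k} (+ 2) x k≡2) (∣l∣*m∣l*x⇔m∣x {+ 2} 6 x)
-- k + + 2 is definitionally k - (- + 2).
12∣k*x⇔6∣x {k} x (inj₂ k≡-2) =
  ⇔.trans (∣k*x⇔∣l*x {+ 12} {k} (- + 2) x k≡-2) (∣l∣*m∣l*x⇔m∣x { - + 2} 6 x)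

6∣x⇔2∣x×3∣x : ∀ x → (+ 6 ∣ x) ⇔ ((+ 2 ∣ x) × (+ 3 ∣ x))
6∣x⇔2∣x×3∣x x = mk⇔
  (λ 6∣x → ℕ.∣-trans (ℕ.divides 3 refl) 6∣x , ℕ.∣-trans (ℕ.divides 2 refl) 6∣x)
  (λ (2∣x , 3∣x) → lcm-least 2∣x 3∣x)

6∣r³-r : ∀ r → r < 6 → + 6 ∣ₛ + r * + r * + r - + r
6∣r³-r 0 _ = divides (+ 0) refl
6∣r³-r 1 _ = divides (+ 0) refl
6∣r³-r 2 _ = divides (+ 1) refl
6∣r³-r 3 _ = divides (+ 4) refl
6∣r³-r 4 _ = divides (+ 10) refl
6∣r³-r 5 _ = divides (+ 20) refl
6∣r³-r (suc (suc (suc (suc (suc (suc _)))))) (ℕ.s≤s (ℕ.s≤s (ℕ.s≤s (ℕ.s≤s (ℕ.s≤s (ℕ.s≤s ()))))))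

6∣n³-n : ∀ n → + 6 ∣ₛ n * n * n - n
6∣n³-n n = subst (λ m → + 6 ∣ₛ m * m * m - m) (sym (a≡a%ℕn+[a/ℕn]*n n 6))
  (subst (+ 6 ∣ₛ_) (sym (expand r q))
    (Signed.∣m∣n⇒∣m+n (6∣r³-r (n %ℕ 6) (n%ℕd<d n 6)) (divides (carry r q) refl)))
  where
  r = + (n %ℕ 6)
  q = n /ℕ 6
  carry : ℤ → ℤ → ℤ
  carry x y = + 3 * x * x * y + + 18 * x * y * y + + 36 * y * y * y - y
  expand : ∀ x y → (x + y * + 6) * (x + y * + 6) * (x + y * + 6) - (x + y * + 6)
                 ≡ (x * x * x - x) + (+ 3 * x * x * y + + 18 * x * y * y + + 36 * y * y * y - y) * + 6
  expand = solve-∀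

6∣[c²-1][d²-1] : ∀ a b c d → a * d - b * c ≡ + 1 → + 6 ∣ₛ (c * c - + 1) * (d * d - + 1)
6∣[c²-1][d²-1] a b c d det≡1 = subst (+ 6 ∣ₛ_) (identity a b c d det≡1)
  (Signed.∣m∣n⇒∣m-n (Signed.∣m⇒∣m*n (c * c - + 1) (Signed.∣n⇒∣m*n a (6∣n³-n d)))
                    (Signed.∣m⇒∣m*n (d * d - + 1) (Signed.∣n⇒∣m*n b (6∣n³-n c))))
  where
  factor : ∀ a b c d → a * (d * d * d - d) * (c * c - + 1) - b * (c * c * c - c) * (d * d - + 1)
                     ≡ (c * c - + 1) * (d * d - + 1) * (a * d - b * c)
  factor = solve-∀
  identity : ∀ a b c d → a * d - b * c ≡ + 1 →
    a * (d * d * d - d) * (c * c - + 1) - b * (c * c * c - c) * (d * d - + 1)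
      ≡ (c * c - + 1) * (d * d - + 1)
  identity a b c d det≡1 = trans (factor a b c d)
    (trans (cong ((c * c - + 1) * (d * d - + 1) *_) det≡1) (*-identityʳ _))

Sinv^n≡ : ∀ n → Sinv ^ n ≡ mat (+ 1) (- + n) (+ 0) (+ 1)
Sinv^n≡ zero = refl
Sinv^n≡ (suc n) = trans (cong (Sinv ·_) (Sinv^n≡ n))
  (cong (λ b → mat (+ 1) b (+ 0) (+ 1)) (identity (+ n)))
  where
  identity : ∀ m → + 1 * - m + - + 1 * + 1 ≡ - (+ 1 + m)
  identity = solve-∀

S^n≡ : ∀ n → S ^ n ≡ mat (+ 1) (+ n) (+ 0) (+ 1)
S^n≡ zero = refl
S^n≡ (suc n) = trans (cong (S ·_) (S^n≡ n))
  (cong (λ b → mat (+ 1) b (+ 0) (+ 1)) (identity (+ n)))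
  where
  identity : ∀ m → + 1 * m + + 1 * + 1 ≡ + 1 + m
  identity = solve-∀

mat-cong : ∀ {a a′ b b′ c c′ d d′} → a ≡ a′ → b ≡ b′ → c ≡ c′ → d ≡ d′ → mat a b c d ≡ mat a′ b′ c′ d′
mat-cong refl refl refl refl = refl

shear·mat : ∀ N a b c d → mat (+ 1) (- N) (+ 0) (+ 1) · mat a b c d ≡ mat (a - N * c) (b - N * d) c d
shear·mat N a b c d = mat-cong (topRow a c N) (topRow b d N) (bottomRow a c) (bottomRow b d)
  where
  topRow : ∀ a c N → + 1 * a + - N * c ≡ a - N * c
  topRow = solve-∀
  bottomRow : ∀ a c → + 0 * a + + 1 * c ≡ c
  bottomRow = solve-∀

f-subRow : ∀ N a b c d →
  f (mat (a - N * c) (b - N * d) c d) ≡ f (mat a b c d) - N + N * ((c * c - + 1) * (d * d - + 1))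
f-subRow N a b c d with ∣ c ∣ % 2
... | zero = identity N a b c d
  where
  identity : ∀ N a b c d →
    (a - N * c + d) * c - (b - N * d) * d * (c * c - + 1) + + 3 * d - + 3 - + 3 * c * d
      ≡ (a + d) * c - b * d * (c * c - + 1) + + 3 * d - + 3 - + 3 * c * d
        - N + N * ((c * c - + 1) * (d * d - + 1))
  identity = solve-∀
... | suc _ = identity N a b c d
  where
  identity : ∀ N a b c d →
    (a - N * c + d) * c - (b - N * d) * d * (c * c - + 1) - + 3 * c
      ≡ (a + d) * c - b * d * (c * c - + 1) - + 3 * c - N + N * ((c * c - + 1) * (d * d - + 1))
  identity = solve-∀

f[Sinv^n·M] : ∀ n M → f (Sinv ^ n · M) ≡ f M - + n + + n * ((c M * c M - + 1) * (d M * d M - + 1))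
f[Sinv^n·M] n (mat a b c d) = begin
  f (Sinv ^ n · mat a b c d)                    ≡⟨ cong (λ X → f (X · mat a b c d)) (Sinv^n≡ n) ⟩
  f (mat (+ 1) (- + n) (+ 0) (+ 1) · mat a b c d) ≡⟨ cong f (shear·mat (+ n) a b c d) ⟩
  f (mat (a - + n * c) (b - + n * d) c d)         ≡⟨ f-subRow (+ n) a b c d ⟩
  f (mat a b c d) - + n + + n * ((c * c - + 1) * (d * d - + 1)) ∎
  where open ≡-Reasoning

f[Sinv^n·S^m] : ∀ n m → f (Sinv ^ n · S ^ m) ≡ + m - + n
f[Sinv^n·S^m] n m = begin
  f (Sinv ^ n · S ^ m) ≡⟨ f[Sinv^n·M] n (S ^ m) ⟩
  f (S ^ m) - + n + + n * ((c (S ^ m) * c (S ^ m) - + 1) * (d (S ^ m) * d (S ^ m) - + 1))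
    ≡⟨ cong (λ X → f X - + n + + n * ((c X * c X - + 1) * (d X * d X - + 1))) (S^n≡ m) ⟩
  f (mat (+ 1) (+ m) (+ 0) (+ 1)) - + n + + n * ((+ 0 * + 0 - + 1) * (+ 1 * + 1 - + 1))
    ≡⟨ identity (+ m) (+ n) ⟩
  + m - + n ∎
  where
  open ≡-Reasoning
  identity : ∀ m n → (+ 1 + + 1) * + 0 - m * + 1 * (+ 0 * + 0 - + 1) + + 3 * + 1 - + 3 - + 3 * + 0 * + 1
                       - n + n * ((+ 0 * + 0 - + 1) * (+ 1 * + 1 - + 1))
                     ≡ m - n
  identity = solve-∀

6∣f[Sinv^[f%6]·M] : ((M , _) : SL2Z) → + 6 ∣ₛ f (Sinv ^ (f M %ℕ 6) · M)
6∣f[Sinv^[f%6]·M] (M , det≡1) = subst (+ 6 ∣ₛ_) (sym (f[Sinv^n·M] r M))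
  (Signed.∣m∣n⇒∣m+n 6∣f-r (Signed.∣n⇒∣m*n (+ r) (6∣[c²-1][d²-1] (a M) (b M) (c M) (d M) det≡1)))
  where
  r = f M %ℕ 6
  cancel : ∀ r q → r + q * + 6 - r ≡ q * + 6
  cancel = solve-∀
  6∣f-r : + 6 ∣ₛ f M - + r
  6∣f-r = divides (f M /ℕ 6)
    (trans (cong (_- + r) (a≡a%ℕn+[a/ℕn]*n (f M) 6)) (cancel (+ r) (f M /ℕ 6)))

∣∸∧<⇒≤ : ∀ {d m n} .{{_ : ℕ.NonZero d}} → d ℕ.∣ m ∸ n → m < d → m ≤ n
∣∸∧<⇒≤ {d} {m} {n} d∣m∸n m<d = m∸n≡0⇒m≤n (begin
  m ∸ n       ≡⟨ sym (m<n⇒m%n≡m (≤-<-trans (m∸n≤m m n) m<d)) ⟩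
  (m ∸ n) % d ≡⟨ ℕ.n∣m⇒m%n≡0 (m ∸ n) d d∣m∸n ⟩
  0           ∎)
  where open ≡-Reasoning

∣⊖∣∧<⇒≡ : ∀ {d m n} .{{_ : ℕ.NonZero d}} → d ℕ.∣ ∣ m ⊖ n ∣ → m < d → n < d → m ≡ n
∣⊖∣∧<⇒≡ {d} {m} {n} d∣m⊖n m<d n<d with ≤-total m n
... | inj₁ m≤n = ≤-antisym m≤n (∣∸∧<⇒≤ (subst (d ℕ.∣_) (∣⊖∣-≤ m≤n) d∣m⊖n) n<d)
... | inj₂ n≤m = ≤-antisym
  (∣∸∧<⇒≤ (subst (d ℕ.∣_) (trans (∣m⊖n∣≡∣n⊖m∣ m n) (∣⊖∣-≤ n≤m)) d∣m⊖n) m<d) n≤m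

mainTheorem6 : (k : ℤ) → (+ 12 ∣ k - + 2) ⊎ (+ 12 ∣ k + + 2) →
    ((M : SL2Z) → InKer k (proj₁ M) ⇔ (InKer (+ 6) (proj₁ M) × InKer (+ 4) (proj₁ M)))
    × ((M : SL2Z) → Σ (Fin 6) (λ n → InKer k ((Sinv ^ toℕ n) · proj₁ M)))
    × ((n n′ : Fin 6) → InKer k ((Sinv ^ toℕ n) · (S ^ toℕ n′)) → n ≡ n′)
mainTheorem6 k k≡±2 = kernel≡∩ , representative , distinct
  where
  inKer⇔6∣f : ∀ M → InKer k M ⇔ (+ 6 ∣ f M)
  inKer⇔6∣f M = 12∣k*x⇔6∣x {k} (f M) k≡±2

  kernel≡∩ : (M : SL2Z) → InKer k (proj₁ M) ⇔ (InKer (+ 6) (proj₁ M) × InKer (+ 4) (proj₁ M))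
  kernel≡∩ (M , _) = ⇔.trans (inKer⇔6∣f M) (⇔.trans (6∣x⇔2∣x×3∣x (f M))
    (⇔.sym (∣l∣*m∣l*x⇔m∣x {+ 6} 2 (f M) ×-⇔ ∣l∣*m∣l*x⇔m∣x {+ 4} 3 (f M))))

  representative : (M : SL2Z) → Σ (Fin 6) (λ n → InKer k ((Sinv ^ toℕ n) · proj₁ M))
  representative M@(M₀ , _) =
    fromℕ< r<6 , Equivalence.from (inKer⇔6∣f (Sinv ^ toℕ (fromℕ< r<6) · M₀))
      (∣⇒∣ᵤ (subst (λ r → + 6 ∣ₛ f (Sinv ^ r · M₀)) (sym (toℕ-fromℕ< r<6)) (6∣f[Sinv^[f%6]·M] M)))
    where
    r<6 = n%ℕd<d (f M₀) 6

  distinct : (n n′ : Fin 6) → InKer k ((Sinv ^ toℕ n) · (S ^ toℕ n′)) → n ≡ n′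
  distinct n n′ inKer =
    toℕ-injective (sym (∣⊖∣∧<⇒≡ {6} {toℕ n′} {toℕ n} 6∣n′⊖n (toℕ<n n′) (toℕ<n n)))
    where
    6∣n′⊖n : 6 ℕ.∣ ∣ toℕ n′ ⊖ toℕ n ∣
    6∣n′⊖n = subst (λ x → + 6 ∣ x)
      (trans (f[Sinv^n·S^m] (toℕ n) (toℕ n′)) (m-n≡m⊖n (toℕ n′) (toℕ n)))
      (Equivalence.to (inKer⇔6∣f (Sinv ^ toℕ n · S ^ toℕ n′)) inKer)
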